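{- Let $n \ge 1$ and let $d$ be a positive divisor of $n$. If $J$ is a zero-sum sequence over $\mathbb{Z}/n\mathbb{Z}$ of length $2n - d$, then $J$ contains a zero-sum subsequence of length $n$.
   Context: A sequence over an abelian group is a finite sequence of elements (repetition allowed); a subsequence is obtained by selecting some of its terms, not necessarily consecutive; a sequence is zero-sum if the sum of its terms is $0$. -}

module Defs where

open import Data.Nat using (ℕ)
open import Data.Nat.Divisibility using (_∣_)
open import Data.Fin using (Fin; toℕ)
open import Data.List using (List; map)
open import Data.Nat.ListAction using (sum)

-- Elements of ℤ/nℤ are represented by Fin n (canonical residues 0..n-1);
-- a sequence over ℤ/nℤ is a List (Fin n).
-- The sum of a sequence in ℤ/nℤ is 0 iff n divides the sum of the
-- canonical representatives.
sumℕ : ∀ {n} → List (Fin n) → ℕ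
sumℕ xs = sum (map toℕ xs)

IsZeroSum : ∀ {n} → List (Fin n) → Set
IsZeroSum {n} xs = n ∣ sumℕ xs

-- The proof goes through the Erdős–Ginzburg–Ziv theorem
-- EGZ(n): among any 2n - 1 integers some n have a sum divisible by n.  Subsequences are
-- handled up to order, as sub-multisets (`Sub`), and made genuine sublists at the end.
--
-- * Blocks: repeated use of EGZ(a) splits a long list into blocks of a elements with sums
--   divisible by a; EGZ(b) applied to the block values sum/a then selects b of them.  This
--   gives EGZ(a) ∧ EGZ(b) ⇒ EGZ(ab) (`egz-*`).
-- * Primes: sort 2p - 1 elements by residue and pair the i-th with the (i+p-1)-th (`pair-up`).
--   A pair of equal residues gives p elements with one residue (`run-selection`); otherwise,
--   by a Cauchy–Davenport argument (`extend-family`, `shift-invariant⇒≋`), choosing one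
--   element from each of the p - 1 pairs reaches every residue (`pairing-selection`).
-- * The proposition: with n = q·d, the (2q - 1)·d terms of J split into 2q - 1 blocks of d
--   terms with sums divisible by d (the last one because d ∣ n ∣ ΣJ), and EGZ(q) selects q
--   of them (`split-into-blocks`, `combine-blocks`).
module Submission where

open import Defs
open import Data.Nat using (ℕ; _≥_; _∸_; _*_)
open import Data.Nat.Divisibility using (_∣_)
open import Data.Fin using (Fin)
open import Data.List using (List; length)
open import Data.List.Relation.Binary.Sublist.Propositional using (_⊆_)
open import Data.Product using (Σ-syntax; _×_)
open import Relation.Binary.PropositionalEquality using (_≡_)

open import Data.Nat
  using (zero; suc; _+_; _≤_; _<_; _<?_; _%_; _/_; _≟_; z≤n; s≤s; z<s; NonZero; >-nonZero; nonTrivial⇒n>1)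
open import Data.Nat.Properties
open import Data.Nat.DivMod
  using (m*[n/m]≡n; %-distribˡ-+; m%n%n≡m%n; m≡m%n+[m/n]*n; %-remove-+ʳ; m%n<n; n%n≡0; m*n%n≡0)
open import Data.Nat.Divisibility
  using (divides; ∣-refl; *-monoʳ-∣; ∣⇒≤; m%n≡0⇒n∣m; ∣-trans; ∣m+n∣m⇒∣n; 1∣_)
open import Data.Nat.Divisibility.Core using (hasNonTrivialDivisor)
open import Data.Nat.Primality using (Prime; euclidsLemma; composite?; ¬composite⇒prime)
open import Data.Nat.Induction using (<-rec)
open import Data.Nat.ListAction using (sum)
open import Data.Nat.ListAction.Properties using (sum-++; sum-↭)
open import Data.Nat.Tactic.RingSolver using (solve-∀)
open import Data.Fin as Fin using (toℕ)
import Data.Fin.Properties as Fin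
open import Data.List using ([]; _∷_; _++_; map; concat; lookup; upTo; take; drop)
open import Data.List.Properties
  using (length-++; length-map; length-upTo; length-take; length-drop; take++drop≡id;
         ++-assoc; ++-identityʳ; ++-conicalˡ; map-++; concat-++)
import Data.List.Relation.Binary.Permutation.Propositional as Perm
open import Data.List.Relation.Binary.Permutation.Propositional
  using (_↭_; ↭-refl; ↭-sym; ↭-trans; ↭-reflexive; prep; swap)
open import Data.List.Relation.Binary.Permutation.Propositional.Properties
  using (++⁺ˡ; ++⁺ʳ; shift; shifts; drop-mid; ↭-length; All-resp-↭; ∈-resp-↭; ↭-empty-inv)
  renaming (map⁺ to ↭-map⁺; ++-comm to ↭-++-comm)
open import Data.List.Relation.Binary.Sublist.Heterogeneous using ([]; _∷ʳ_; _∷_)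
open import Data.List.Relation.Unary.Any as Any using (here)
import Data.List.Relation.Unary.Any.Properties as Any
open import Data.List.Relation.Unary.All as All using (All; []; _∷_; all?)
import Data.List.Relation.Unary.All.Properties as All
open import Data.List.Relation.Unary.AllPairs as AllPairs using (AllPairs; []; _∷_)
import Data.List.Relation.Unary.AllPairs.Properties as AllPairs
open import Data.List.Relation.Unary.Sorted.TotalOrder.Properties using (Sorted⇒AllPairs)
import Data.List.Sort
open import Data.List.Membership.Propositional using (_∈_; find)
open import Data.List.Membership.Propositional.Properties
  using (∈-∃++; ∈-++⁻; ∈-++⁺ʳ; ∈-lookup; ∈-upTo⁺; ∈-map⁻; ∈-map⁺)
open import Data.List.Membership.DecPropositional _≟_ using (_∈?_)
open import Data.Product using (_,_; proj₁; proj₂; ∃₂)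
open import Data.Sum using (_⊎_; inj₁; inj₂)
open import Data.Empty using (⊥-elim)
open import Relation.Nullary using (¬_; yes; no)
open import Relation.Binary.Bundles using (DecTotalOrder)
import Relation.Binary.Construct.On as On
open import Relation.Binary.PropositionalEquality
  using (_≢_; refl; sym; trans; cong; cong₂; subst; subst₂; module ≡-Reasoning)

Sub : {A : Set} → List A → List A → Set
Sub {A} T L = Σ[ R ∈ List A ] L ↭ T ++ R

sub-trans : {A : Set} {T M L : List A} → Sub T M → Sub M L → Sub T L
sub-trans {T = T} (R₂ , M↭) (R₁ , L↭) =
  R₂ ++ R₁ , ↭-trans L↭ (↭-trans (++⁺ʳ R₁ M↭) (↭-reflexive (++-assoc T R₂ R₁)))

sub-∷ : {A : Set} {T L : List A} (x : A) → Sub T L → Sub (x ∷ T) (x ∷ L)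
sub-∷ x (R , L↭) = R , prep x L↭

sub-skip : {A : Set} {T L : List A} (x : A) → Sub T L → Sub T (x ∷ L)
sub-skip {T = T} x (R , L↭) = x ∷ R , ↭-trans (prep x L↭) (↭-sym (shift x T R))

sub-↭ : {A : Set} {L L' : List A} → L' ↭ L → Sub L L'
sub-↭ {L = L} L'↭L = [] , ↭-trans L'↭L (↭-reflexive (sym (++-identityʳ L)))

all-sub : {A : Set} {P : A → Set} {T L : List A} → Sub T L → All P L → All P T
all-sub {T = T} (R , L↭) all = All.++⁻ˡ T (All-resp-↭ L↭ all)

concat-↭ : {A : Set} {Bs Cs : List (List A)} → Bs ↭ Cs → concat Bs ↭ concat Cs
concat-↭ Perm.refl = ↭-refl
concat-↭ (prep B p) = ++⁺ˡ B (concat-↭ p)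
concat-↭ (swap B C p) = ↭-trans (++⁺ˡ B (++⁺ˡ C (concat-↭ p))) (shifts B C)
concat-↭ (Perm.trans p q) = ↭-trans (concat-↭ p) (concat-↭ q)

sub-concat : {A : Set} {Cs Bs : List (List A)} → Sub Cs Bs → Sub (concat Cs) (concat Bs)
sub-concat {Cs = Cs} (Ds , Bs↭) = concat Ds , ↭-trans (concat-↭ Bs↭) (↭-reflexive (sym (concat-++ Cs Ds)))

cancel-chosen : {A : Set} {x : A} {J : List A} (T₁ T₂ R : List A) →
  x ∷ J ↭ (T₁ ++ x ∷ T₂) ++ R → J ↭ (T₁ ++ T₂) ++ R
cancel-chosen T₁ T₂ R x∷J↭ =
  ↭-trans (drop-mid [] T₁ (↭-trans x∷J↭ (↭-reflexive (++-assoc T₁ (_ ∷ T₂) R))))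
          (↭-reflexive (sym (++-assoc T₁ T₂ R)))

cancel-rest : {A : Set} {x : A} {J : List A} (T R₁ R₂ : List A) →
  x ∷ J ↭ T ++ (R₁ ++ x ∷ R₂) → J ↭ T ++ (R₁ ++ R₂)
cancel-rest T R₁ R₂ x∷J↭ =
  ↭-trans (drop-mid [] (T ++ R₁) (↭-trans x∷J↭ (↭-reflexive (sym (++-assoc T R₁ (_ ∷ R₂))))))
          (↭-reflexive (++-assoc T R₁ R₂))

sub⇒sublist : {A : Set} {T J : List A} → Sub T J → Σ[ T₀ ∈ List A ] (T₀ ⊆ J × T₀ ↭ T)
sub⇒sublist {T = T} {J = []} (R , []↭) with refl ← ++-conicalˡ T R (↭-empty-inv (↭-sym []↭)) =
  [] , [] , ↭-refl
sub⇒sublist {T = T} {J = x ∷ J} (R , x∷J↭) with ∈-++⁻ T (∈-resp-↭ x∷J↭ (here refl))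
... | inj₁ x∈T
    with T₁ , T₂ , refl ← ∈-∃++ x∈T
    with T₀ , T₀⊆J , T₀↭ ← sub⇒sublist (R , cancel-chosen T₁ T₂ R x∷J↭)
  = x ∷ T₀ , refl ∷ T₀⊆J , ↭-trans (prep x T₀↭) (↭-sym (shift x T₁ T₂))
... | inj₂ x∈R
    with R₁ , R₂ , refl ← ∈-∃++ x∈R
    with T₀ , T₀⊆J , T₀↭ ← sub⇒sublist (R₁ ++ R₂ , cancel-rest T R₁ R₂ x∷J↭)
  = T₀ , x ∷ʳ T₀⊆J , T₀↭

sumBy : {A : Set} → (A → ℕ) → List A → ℕ
sumBy f xs = sum (map f xs)

sumBy-++ : {A : Set} (f : A → ℕ) (xs ys : List A) → sumBy f (xs ++ ys) ≡ sumBy f xs + sumBy f ys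
sumBy-++ f xs ys = trans (cong sum (map-++ f xs ys)) (sum-++ (map f xs) (map f ys))

sumBy-↭ : {A : Set} (f : A → ℕ) {xs ys : List A} → xs ↭ ys → sumBy f xs ≡ sumBy f ys
sumBy-↭ f xs↭ys = sum-↭ (↭-map⁺ f xs↭ys)

record Selection {A : Set} (m : ℕ) (f : A → ℕ) (xs : List A) : Set where
  constructor selection
  field
    chosen        : List A
    chosen-sub    : Sub chosen xs
    chosen-length : length chosen ≡ m
    chosen-sum    : m ∣ sumBy f chosen

selection-sub : {A : Set} {m : ℕ} {f : A → ℕ} {xs ys : List A} →
  Sub xs ys → Selection m f xs → Selection m f ys
selection-sub xs⊆ys (selection T T⊆xs len m∣sum) = selection T (sub-trans T⊆xs xs⊆ys) len m∣sum

EGZ : ℕ → Set₁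
EGZ n = ∀ {A : Set} (f : A → ℕ) (xs : List A) → n + n ≤ suc (length xs) → Selection n f xs

egz-0 : EGZ 0
egz-0 f xs _ = selection [] (xs , ↭-refl) refl ∣-refl

egz-1 : EGZ 1
egz-1 f [] (s≤s ())
egz-1 f (x ∷ xs) _ = selection (x ∷ []) (xs , ↭-refl) refl (1∣ _)

Block : {A : Set} → ℕ → (A → ℕ) → List A → Set
Block a f B = length B ≡ a × a ∣ sumBy f B

blockValue : {A : Set} (a : ℕ) .{{_ : NonZero a}} → (A → ℕ) → List A → ℕ
blockValue a f B = sumBy f B / a

length-concat-blocks : {A : Set} {a : ℕ} {f : A → ℕ} (Bs : List (List A)) →
  All (Block a f) Bs → length (concat Bs) ≡ length Bs * a
length-concat-blocks [] [] = refl
length-concat-blocks (B ∷ Bs) ((len , _) ∷ blocks) =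
  trans (length-++ B) (cong₂ _+_ len (length-concat-blocks Bs blocks))

sum-concat-blocks : {A : Set} (a : ℕ) .{{_ : NonZero a}} (f : A → ℕ) (Bs : List (List A)) →
  All (Block a f) Bs → sumBy f (concat Bs) ≡ a * sumBy (blockValue a f) Bs
sum-concat-blocks a f [] [] = sym (*-zeroʳ a)
sum-concat-blocks a f (B ∷ Bs) ((_ , a∣B) ∷ blocks) = begin
  sumBy f (B ++ concat Bs)                                ≡⟨ sumBy-++ f B (concat Bs) ⟩
  sumBy f B + sumBy f (concat Bs)                         ≡⟨ cong₂ _+_ (sym (m*[n/m]≡n a∣B))
                                                                       (sum-concat-blocks a f Bs blocks) ⟩
  a * blockValue a f B + a * sumBy (blockValue a f) Bs   ≡⟨ sym (*-distribˡ-+ a _ _) ⟩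
  a * sumBy (blockValue a f) (B ∷ Bs)                     ∎
  where open ≡-Reasoning

record BlockSplit {A : Set} (a k : ℕ) (f : A → ℕ) (xs : List A) : Set where
  constructor blockSplit
  field
    blocks       : List (List A)
    remainder    : List A
    blocks-count : length blocks ≡ k
    blocks-valid : All (Block a f) blocks
    split        : xs ↭ concat blocks ++ remainder

remaining-bound : {A : Set} (a k : ℕ) {xs B R : List A} → xs ↭ B ++ R → length B ≡ a →
  suc k * a + a ≤ suc (length xs) → k * a + a ≤ suc (length R)
remaining-bound a k {xs} {B} {R} xs↭ len-B bound = +-cancelˡ-≤ a _ _ (begin
  a + (k * a + a)           ≡⟨ sym (+-assoc a (k * a) a) ⟩
  suc k * a + a             ≤⟨ bound ⟩
  suc (length xs)           ≡⟨ cong suc (trans (↭-length xs↭) (length-++ B)) ⟩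
  suc (length B + length R) ≡⟨ cong (λ l → suc (l + length R)) len-B ⟩
  suc (a + length R)        ≡⟨ sym (+-suc a (length R)) ⟩
  a + suc (length R)        ∎)
  where open ≤-Reasoning

split-blocks : {a : ℕ} → EGZ a → {A : Set} (f : A → ℕ) (k : ℕ) (xs : List A) →
  k * a + a ≤ suc (length xs) → BlockSplit a k f xs
split-blocks egz f zero xs _ = blockSplit [] xs refl [] ↭-refl
split-blocks {a} egz f (suc k) xs bound
  with selection B (R , xs↭) len-B a∣B ← egz f xs (≤-trans (+-monoˡ-≤ a (m≤m+n a (k * a))) bound)
  with blockSplit Bs rest count valid R↭ ← split-blocks egz f k R (remaining-bound a k {B = B} xs↭ len-B bound)
  = blockSplit (B ∷ Bs) rest (cong suc count) ((len-B , a∣B) ∷ valid)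
      (↭-trans xs↭ (↭-trans (++⁺ˡ B R↭) (↭-reflexive (sym (++-assoc B (concat Bs) rest)))))

combine-blocks : (a b : ℕ) .{{_ : NonZero a}} → EGZ b → {A : Set} (f : A → ℕ) (Bs : List (List A)) →
  All (Block a f) Bs → b + b ≤ suc (length Bs) → Selection (b * a) f (concat Bs)
combine-blocks a b egz f Bs valid bound
  with selection Cs Cs⊆Bs count b∣values ← egz (blockValue a f) Bs bound =
  selection (concat Cs) (sub-concat Cs⊆Bs)
    (trans (length-concat-blocks Cs valid-Cs) (cong (_* a) count))
    (subst (_∣ sumBy f (concat Cs)) (*-comm a b)
      (subst (a * b ∣_) (sym (sum-concat-blocks a f Cs valid-Cs)) (*-monoʳ-∣ a b∣values)))
  where
  valid-Cs : All (Block a f) Cs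
  valid-Cs = all-sub Cs⊆Bs valid

-- 2(b+1)·a = (2b + 1)·a + a: room for 2(b+1) - 1 blocks of size a.
double-product : ∀ a b′ → suc b′ * a + suc b′ * a ≡ (b′ + suc b′) * a + a
double-product = solve-∀

egz-* : (a b : ℕ) .{{_ : NonZero a}} → EGZ a → EGZ b → EGZ (b * a)
egz-* a zero _ _ = egz-0
egz-* a b@(suc b′) egz-a egz-b f xs bound
  with blockSplit Bs R count valid xs↭ ←
         split-blocks egz-a f (b′ + b) xs (subst (_≤ suc (length xs)) (double-product a b′) bound)
  with selection T T⊆Bs len-T sum-T ← combine-blocks a b egz-b f Bs valid (≤-reflexive (cong suc (sym count)))
  = selection T (sub-trans T⊆Bs (R , xs↭)) len-T sum-T

pigeonhole-∈ : {X : Set} (L : List X) {m : ℕ} (h : Fin m → X) → (∀ i → h i ∈ L) → length L < m →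
  ∃₂ λ i j → i Fin.< j × h i ≡ h j
pigeonhole-∈ L h h∈L |L|<m with i , j , i<j , same-index ← Fin.pigeonhole |L|<m (λ i → Any.index (h∈L i)) =
  i , j , i<j ,
  trans (Any.lookup-index (h∈L i)) (trans (cong (lookup L) same-index) (sym (Any.lookup-index (h∈L j))))

allPairs-lookup : {X : Set} {R : X → X → Set} {xs : List X} → AllPairs R xs →
  {i j : Fin (length xs)} → i Fin.< j → R (lookup xs i) (lookup xs j)
allPairs-lookup (R-head ∷ _) {Fin.zero} {Fin.suc j} _ = All.lookup R-head (∈-lookup j)
allPairs-lookup (_ ∷ R-tail) {Fin.suc i} {Fin.suc j} (s≤s i<j) = allPairs-lookup R-tail i<j

distinct-covers : (m : ℕ) (Rs : List ℕ) → AllPairs _≢_ Rs → All (_< m) Rs → m ≤ length Rs →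
  ∀ {r} → r < m → r ∈ Rs
distinct-covers m Rs distinct bounded m≤|Rs| {r} r<m with r ∈? Rs
... | yes r∈Rs = r∈Rs
... | no r∉Rs with pigeonhole-∈ (upTo m) h h∈upTo (s≤s (≤-trans (≤-reflexive (length-upTo m)) m≤|Rs|))
  where
  h : Fin (suc (length Rs)) → ℕ
  h Fin.zero = r
  h (Fin.suc k) = lookup Rs k
  h∈upTo : ∀ i → h i ∈ upTo m
  h∈upTo Fin.zero = ∈-upTo⁺ r<m
  h∈upTo (Fin.suc k) = ∈-upTo⁺ (All.lookup bounded (∈-lookup k))
... | Fin.zero , Fin.suc k , _ , r≡ = ⊥-elim (r∉Rs (subst (_∈ Rs) (sym r≡) (∈-lookup k)))
... | Fin.suc k , Fin.suc k′ , s≤s k<k′ , same = ⊥-elim (allPairs-lookup distinct k<k′ same)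

module Congruence (m : ℕ) .{{_ : NonZero m}} where

  infix 4 _≋_
  _≋_ : ℕ → ℕ → Set
  x ≋ y = x % m ≡ y % m

  %-≋ : ∀ x → x % m ≋ x
  %-≋ x = m%n%n≡m%n x m

  ≋-+ˡ : ∀ z {x y} → x ≋ y → z + x ≋ z + y
  ≋-+ˡ z {x} {y} x≋y = begin
    (z + x) % m             ≡⟨ %-distribˡ-+ z x m ⟩
    (z % m + x % m) % m     ≡⟨ cong (λ r → (z % m + r) % m) x≋y ⟩
    (z % m + y % m) % m     ≡⟨ %-distribˡ-+ z y m ⟨
    (z + y) % m             ∎
    where open ≡-Reasoning

  ≋-+ʳ : ∀ z {x y} → x ≋ y → x + z ≋ y + z
  ≋-+ʳ z {x} {y} x≋y = trans (cong (_% m) (+-comm x z)) (trans (≋-+ˡ z x≋y) (cong (_% m) (+-comm z y)))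

  ≋⇒∣∸ : ∀ {x y} → x ≋ y → m ∣ x ∸ y
  ≋⇒∣∸ {x} {y} x≋y = divides (x / m ∸ y / m) (begin
    x ∸ y                                     ≡⟨ cong₂ _∸_ (m≡m%n+[m/n]*n x m) (m≡m%n+[m/n]*n y m) ⟩
    (x % m + x / m * m) ∸ (y % m + y / m * m) ≡⟨ cong (λ r → (r + x / m * m) ∸ (y % m + y / m * m)) x≋y ⟩
    (y % m + x / m * m) ∸ (y % m + y / m * m) ≡⟨ [m+n]∸[m+o]≡n∸o (y % m) _ _ ⟩
    x / m * m ∸ y / m * m                     ≡⟨ *-distribʳ-∸ m (x / m) (y / m) ⟨
    (x / m ∸ y / m) * m                       ∎)
    where open ≡-Reasoning

  ∣∸⇒≋ : ∀ {x y} → y ≤ x → m ∣ x ∸ y → x ≋ y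
  ∣∸⇒≋ {x} {y} y≤x m∣x∸y = trans (cong (_% m) (sym (m+[n∸m]≡n y≤x))) (%-remove-+ʳ y m∣x∸y)

  ≋-cancel-≤ : ∀ z {x y} → y ≤ x → z + x ≋ z + y → x ≋ y
  ≋-cancel-≤ z {x} {y} y≤x eq =
    ∣∸⇒≋ y≤x (subst (m ∣_) ([m+n]∸[m+o]≡n∸o z x y) (≋⇒∣∸ eq))

  ≋-cancelˡ : ∀ z {x y} → z + x ≋ z + y → x ≋ y
  ≋-cancelˡ z {x} {y} eq with ≤-total y x
  ... | inj₁ y≤x = ≋-cancel-≤ z y≤x eq
  ... | inj₂ x≤y = sym (≋-cancel-≤ z x≤y (sym eq))

  sum-≋ : {A : Set} (f : A → ℕ) {c : ℕ} (W : List A) → All (λ w → f w % m ≡ c) W →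
    sumBy f W ≋ length W * c
  sum-≋ f [] [] = refl
  sum-≋ f {c} (w ∷ W) (fw≡c ∷ rest) = begin
    (f w + sumBy f W) % m      ≡⟨ ≋-+ˡ (f w) (sum-≋ f W rest) ⟩
    (f w + length W * c) % m   ≡⟨ ≋-+ʳ (length W * c) fw≋c ⟩
    (c + length W * c) % m     ∎
    where
    open ≡-Reasoning
    fw≋c : f w ≋ c
    fw≋c = trans (sym (%-≋ (f w))) (cong (_% m) fw≡c)

  orbit-collision : ∀ s s₀ α β i t → s + i * α ≋ s₀ + i * β →
    s + (i + t) * α ≋ s₀ + (i + t) * β → t * α ≋ t * β
  orbit-collision s s₀ α β i t at-i at-i+t = ≋-cancelˡ (s₀ + i * β) (begin
    (s₀ + i * β + t * α) % m ≡⟨ ≋-+ʳ (t * α) (sym at-i) ⟩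
    (s + i * α + t * α) % m  ≡⟨ cong (_% m) (regroup s i t α) ⟩
    (s + (i + t) * α) % m    ≡⟨ at-i+t ⟩
    (s₀ + (i + t) * β) % m   ≡⟨ cong (_% m) (regroup s₀ i t β) ⟨
    (s₀ + i * β + t * β) % m ∎)
    where
    open ≡-Reasoning
    regroup : ∀ a b c d → a + b * d + c * d ≡ a + (b + c) * d
    regroup = solve-∀

  shift-orbit : (X : List ℕ) {α β s₀ : ℕ} → s₀ ∈ X →
    (∀ {s} → s ∈ X → Σ[ s′ ∈ ℕ ] (s′ ∈ X × β + s ≋ α + s′)) →
    ∀ k → Σ[ s ∈ ℕ ] (s ∈ X × s + k * α ≋ s₀ + k * β)
  shift-orbit X s₀∈X closed zero = _ , s₀∈X , refl
  shift-orbit X {α} {β} {s₀} s₀∈X closed (suc k)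
    with s , s∈X , at-k ← shift-orbit X s₀∈X closed k
    with s′ , s′∈X , step ← closed s∈X
    = s′ , s′∈X , (begin
      (s′ + (α + k * α)) % m   ≡⟨ cong (_% m) (swap-first s′ α (k * α)) ⟩
      (α + s′ + k * α) % m     ≡⟨ ≋-+ʳ (k * α) (sym step) ⟩
      (β + s + k * α) % m      ≡⟨ cong (_% m) (+-assoc β s (k * α)) ⟩
      (β + (s + k * α)) % m    ≡⟨ ≋-+ˡ β at-k ⟩
      (β + (s₀ + k * β)) % m   ≡⟨ cong (_% m) (+-comm-middle β s₀ (k * β)) ⟩
      (s₀ + (β + k * β)) % m   ∎)
    where
    open ≡-Reasoning
    swap-first : ∀ a b c → a + (b + c) ≡ b + a + c
    swap-first = solve-∀
    +-comm-middle : ∀ a b c → a + (b + c) ≡ b + (a + c)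
    +-comm-middle = solve-∀

module PrimeCongruence (p : ℕ) .{{_ : NonZero p}} (isPrime : Prime p) where
  open Congruence p

  ≋-*-cancel-≤ : ∀ {t x y} → 0 < t → t < p → y ≤ x → t * x ≋ t * y → x ≋ y
  ≋-*-cancel-≤ {t} {x} {y} 0<t t<p y≤x eq
    with euclidsLemma t (x ∸ y) isPrime
           (subst (p ∣_) (sym (*-distribˡ-∸ t x y)) (≋⇒∣∸ eq))
  ... | inj₁ p∣t = ⊥-elim (<⇒≱ t<p (∣⇒≤ {{>-nonZero 0<t}} p∣t))
  ... | inj₂ p∣x∸y = ∣∸⇒≋ y≤x p∣x∸y

  ≋-*-cancelˡ : ∀ {t x y} → 0 < t → t < p → t * x ≋ t * y → x ≋ y
  ≋-*-cancelˡ {t} {x} {y} 0<t t<p eq with ≤-total y x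
  ... | inj₁ y≤x = ≋-*-cancel-≤ 0<t t<p y≤x eq
  ... | inj₂ x≤y = sym (≋-*-cancel-≤ 0<t t<p x≤y (sym eq))

  -- A nonempty set X of fewer than p numbers with β + X ⊆ α + X modulo p forces α ≋ β:
  -- otherwise X would contain the p distinct points of an orbit.
  shift-invariant⇒≋ : (X : List ℕ) {α β : ℕ} → 0 < length X → length X < p →
    (∀ {s} → s ∈ X → Σ[ s′ ∈ ℕ ] (s′ ∈ X × β + s ≋ α + s′)) → α ≋ β
  shift-invariant⇒≋ X@(s₀ ∷ _) {α} {β} _ |X|<p closed
    with i , j , i<j , same ← pigeonhole-∈ X (λ i → proj₁ (shift-orbit X (here refl) closed (toℕ i)))
                                (λ i → proj₁ (proj₂ (shift-orbit X (here refl) closed (toℕ i)))) |X|<p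
    = ≋-*-cancelˡ (m<n⇒0<n∸m i<j) (≤-<-trans (m∸n≤m (toℕ j) (toℕ i)) (Fin.toℕ<n j))
        (orbit-collision _ s₀ α β (toℕ i) (toℕ j ∸ toℕ i) (proj₂ (proj₂ (orbit (toℕ i)))) at-j)
    where
    orbit = shift-orbit X (here refl) closed
    at-j : proj₁ (orbit (toℕ i)) + (toℕ i + (toℕ j ∸ toℕ i)) * α
           ≋ s₀ + (toℕ i + (toℕ j ∸ toℕ i)) * β
    at-j rewrite m+[n∸m]≡n (<⇒≤ i<j) | same = proj₂ (proj₂ (orbit (toℕ j)))

unpair : {A : Set} → List (A × A) → List A
unpair [] = []
unpair ((a , b) ∷ Ps) = a ∷ b ∷ unpair Ps

-- A pick from the pairs Ps: as many of their elements as there are pairs (in the proof,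
-- always one element of each pair).
Pick : {A : Set} → List (A × A) → List A → Set
Pick Ps T = Sub T (unpair Ps) × length T ≡ length Ps

pick-first : {A : Set} {a b : A} {Ps : List (A × A)} {T : List A} → Pick Ps T → Pick ((a , b) ∷ Ps) (a ∷ T)
pick-first {a = a} {b} (T⊆ , len) = sub-∷ a (sub-skip b T⊆) , cong suc len

pick-second : {A : Set} {a b : A} {Ps : List (A × A)} {T : List A} → Pick Ps T → Pick ((a , b) ∷ Ps) (b ∷ T)
pick-second {a = a} {b} (T⊆ , len) = sub-skip a (sub-∷ b T⊆) , cong suc len

DistinctPair : {A : Set} → (A → ℕ) → A × A → Set
DistinctPair k (a , b) = k a ≢ k b

Sorted : {A : Set} → (A → ℕ) → List A → Set
Sorted k = AllPairs (λ x y → k x ≤ k y)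

module _ {A : Set} (k : A → ℕ) where
  private
    byKey = On.decTotalOrder ≤-decTotalOrder k
    module ByKey = Data.List.Sort byKey

  sortBy : List A → List A
  sortBy = ByKey.sort

  sortBy-↭ : ∀ xs → sortBy xs ↭ xs
  sortBy-↭ = ByKey.sort-↭

  sortBy-sorted : ∀ xs → Sorted k (sortBy xs)
  sortBy-sorted xs = Sorted⇒AllPairs (DecTotalOrder.totalOrder byKey) (ByKey.sort-↗ xs)

before-≤ : {A : Set} {k : A → ℕ} (M : List A) {y : A} {Q : List A} →
  Sorted k (M ++ y ∷ Q) → All (λ w → k w ≤ k y) M
before-≤ [] _ = []
before-≤ (w ∷ M) (w≤ ∷ sorted) = All.lookup w≤ (∈-++⁺ʳ M (here refl)) ∷ before-≤ M sorted

sorted-run-constant : {A : Set} {k : A → ℕ} (x : A) (M : List A) (y : A) (Q : List A) →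
  Sorted k (x ∷ M ++ y ∷ Q) → k x ≡ k y → All (λ w → k w ≡ k x) (x ∷ M ++ y ∷ [])
sorted-run-constant {k = k} x M y Q (x≤ ∷ sorted) kx≡ky =
  refl ∷ All.++⁺ (All.zipWith squeeze (before-≤ M sorted , All.++⁻ˡ M x≤)) (sym kx≡ky ∷ [])
  where
  squeeze : ∀ {w} → k w ≤ k y × k x ≤ k w → k w ≡ k x
  squeeze {w} (w≤y , x≤w) = ≤-antisym (subst (k w ≤_) (sym kx≡ky) w≤y) x≤w

record ConstantRun {A : Set} (k : A → ℕ) (xs : List A) (len : ℕ) : Set where
  constructor constantRun
  field
    run          : List A
    run-sub      : Sub run xs
    run-length   : length run ≡ len
    run-key      : ℕ
    run-constant : All (λ w → k w ≡ run-key) run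

record Pairing {A : Set} (k : A → ℕ) (xs : List A) (n : ℕ) : Set where
  constructor pairing
  field
    pairs          : List (A × A)
    extra          : A
    others         : List A
    pairs-distinct : All (DistinctPair k) pairs
    pairs-count    : length pairs ≡ n
    arrangement    : xs ↭ unpair pairs ++ extra ∷ others

-- Pair the i-th element of P with the i-th element of Q in the sorted list P ++ D ++ Q.
pair-up : {A : Set} (k : A → ℕ) (P D Q : List A) → Sorted k (P ++ D ++ Q) → length P < length Q →
  ConstantRun k (P ++ D ++ Q) (suc (length P + length D)) ⊎ Pairing k (P ++ Q) (length P)
pair-up k [] D (y ∷ Q) _ _ = inj₂ (pairing [] y Q [] refl ↭-refl)
pair-up k (x ∷ P) D (y ∷ Q) sorted (s≤s |P|<|Q|) with k x ≟ k y
... | yes kx≡ky =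
  inj₁ (constantRun (x ∷ (P ++ D) ++ y ∷ []) (Q , ↭-reflexive (cong (x ∷_) regroup))
          (cong suc run-length) (k x)
          (sorted-run-constant x (P ++ D) y Q (subst (Sorted k) (cong (x ∷_) regroup′) sorted) kx≡ky))
  where
  regroup : P ++ D ++ y ∷ Q ≡ ((P ++ D) ++ y ∷ []) ++ Q
  regroup = sym (trans (++-assoc (P ++ D) (y ∷ []) Q) (++-assoc P D (y ∷ Q)))
  regroup′ : P ++ D ++ y ∷ Q ≡ (P ++ D) ++ y ∷ Q
  regroup′ = sym (++-assoc P D (y ∷ Q))
  run-length : length ((P ++ D) ++ y ∷ []) ≡ suc (length P + length D)
  run-length = trans (length-++ (P ++ D)) (trans (+-comm _ 1) (cong suc (length-++ P)))
... | no kx≢ky with pair-up k P (D ++ y ∷ []) Q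
                      (subst (Sorted k) (cong (P ++_) (sym (++-assoc D (y ∷ []) Q))) (AllPairs.tail sorted)) |P|<|Q|
...   | inj₁ (constantRun W W⊆ len c constant) =
  inj₁ (constantRun W (sub-trans W⊆ (sub-skip x (sub-↭ (↭-reflexive move-y)))) (trans len (cong suc moved-length))
          c constant)
  where
  move-y : P ++ D ++ y ∷ Q ≡ P ++ (D ++ y ∷ []) ++ Q
  move-y = cong (P ++_) (sym (++-assoc D (y ∷ []) Q))
  moved-length : length P + length (D ++ y ∷ []) ≡ suc (length P + length D)
  moved-length = trans (cong (length P +_) (trans (length-++ D) (+-comm _ 1))) (+-suc (length P) (length D))
...   | inj₂ (pairing Ps c others distinct count arrangement) =
  inj₂ (pairing ((x , y) ∷ Ps) c others (kx≢ky ∷ distinct) (cong suc count)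
          (prep x (↭-trans (shift y P Q) (prep y arrangement))))

run-selection : {A : Set} (m : ℕ) .{{_ : NonZero m}} (f : A → ℕ) {ys : List A} {len : ℕ} →
  ConstantRun (λ x → f x % m) ys len → len ≡ m → Selection m f ys
run-selection m f (constantRun W W⊆ys len-W c constant) refl =
  selection W W⊆ys len-W (m%n≡0⇒n∣m (sumBy f W) m (begin
    sumBy f W % m        ≡⟨ sum-≋ f W constant ⟩
    (length W * c) % m   ≡⟨ cong (λ l → (l * c) % m) len-W ⟩
    (m * c) % m          ≡⟨ cong (_% m) (*-comm m c) ⟩
    (c * m) % m          ≡⟨ m*n%n≡0 c m ⟩
    0                    ∎))
  where
  open ≡-Reasoning
  open Congruence m

module Residues (p : ℕ) .{{_ : NonZero p}} (isPrime : Prime p) where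
  open Congruence p
  open PrimeCongruence p isPrime

  residue : {A : Set} → (A → ℕ) → List A → ℕ
  residue f T = sumBy f T % p

  record ResidueFamily {A : Set} (f : A → ℕ) (Ps : List (A × A)) (size : ℕ) : Set where
    constructor family
    field
      members          : List (List A)
      members-pick     : All (Pick Ps) members
      members-distinct : AllPairs (λ T T′ → residue f T ≢ residue f T′) members
      members-many     : size ≤ length members

  distinct-∷ : {A : Set} (f : A → ℕ) (a : A) {Ls : List (List A)} →
    AllPairs (λ T T′ → residue f T ≢ residue f T′) Ls →
    AllPairs (λ T T′ → residue f T ≢ residue f T′) (map (a ∷_) Ls)
  distinct-∷ f a distinct =
    AllPairs.map⁺ (AllPairs.map (λ T≢T′ aT≡aT′ → T≢T′ (≋-cancelˡ (f a) aT≡aT′)) distinct)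

  residues-shift-closed : {A : Set} (f : A → ℕ) (a b : A) (Ls : List (List A)) →
    All (λ T → residue f (b ∷ T) ∈ map (residue f) (map (a ∷_) Ls)) Ls →
    ∀ {s} → s ∈ map (residue f) Ls → Σ[ s′ ∈ ℕ ] (s′ ∈ map (residue f) Ls × f b + s ≋ f a + s′)
  residues-shift-closed f a b Ls no-new s∈
    with T , T∈Ls , refl ← ∈-map⁻ (residue f) s∈
    with U , U∈ , bT≡U ← ∈-map⁻ (residue f) (All.lookup no-new T∈Ls)
    with T′ , T′∈Ls , refl ← ∈-map⁻ (a ∷_) U∈
    = residue f T′ , ∈-map⁺ (residue f) T′∈Ls , (begin
      (f b + residue f T) % p    ≡⟨ ≋-+ˡ (f b) (%-≋ (sumBy f T)) ⟩
      (f b + sumBy f T) % p      ≡⟨ bT≡U ⟩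
      (f a + sumBy f T′) % p     ≡⟨ ≋-+ˡ (f a) (%-≋ (sumBy f T′)) ⟨
      (f a + residue f T′) % p   ∎)
    where open ≡-Reasoning

  -- Cauchy–Davenport step: adding a pair of distinct residues to fewer than p pairs
  -- increases the number of attainable residues by one.
  extend-family : {A : Set} (f : A → ℕ) {a b : A} {Ps : List (A × A)} → ¬ (f a ≋ f b) →
    suc (suc (length Ps)) ≤ p → ResidueFamily f Ps (suc (length Ps)) →
    ResidueFamily f ((a , b) ∷ Ps) (suc (suc (length Ps)))
  extend-family f {a} {b} a≢b bound (family Ls picks distinct many) with length Ls <? p
  ... | no |Ls|≮p =
    family (map (a ∷_) Ls) (All.map⁺ (All.map pick-first picks)) (distinct-∷ f a distinct)
      (≤-trans bound (≤-trans (≮⇒≥ |Ls|≮p) (≤-reflexive (sym (length-map (a ∷_) Ls)))))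
  ... | yes |Ls|<p with all? (λ T → residue f (b ∷ T) ∈? map (residue f) (map (a ∷_) Ls)) Ls
  ...   | yes no-new =
    ⊥-elim (a≢b (shift-invariant⇒≋ (map (residue f) Ls)
                   (subst (0 <_) (sym (length-map (residue f) Ls)) (≤-trans (s≤s z≤n) many))
                   (subst (_< p) (sym (length-map (residue f) Ls)) |Ls|<p)
                   (residues-shift-closed f a b Ls no-new)))
  ...   | no some-new
    with T , T∈Ls , new ← find (All.¬All⇒Any¬ (λ T → residue f (b ∷ T) ∈? _) Ls some-new) =
    family ((b ∷ T) ∷ map (a ∷_) Ls)
      (pick-second (All.lookup picks T∈Ls) ∷ All.map⁺ (All.map pick-first picks))
      (All.map⁻ (All.¬Any⇒All¬ _ new) ∷ distinct-∷ f a distinct)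
      (s≤s (≤-trans many (≤-reflexive (sym (length-map (a ∷_) Ls)))))

  residue-family : {A : Set} (f : A → ℕ) (Ps : List (A × A)) → All (DistinctPair (λ x → f x % p)) Ps →
    length Ps < p → ResidueFamily f Ps (suc (length Ps))
  residue-family f [] [] _ = family ([] ∷ []) ((([] , ↭-refl) , refl) ∷ []) ([] ∷ []) ≤-refl
  residue-family f ((a , b) ∷ Ps) (a≢b ∷ distinct) bound =
    extend-family f a≢b bound (residue-family f Ps distinct (<-trans (n<1+n _) bound))

  family-covers : {A : Set} {f : A → ℕ} {Ps : List (A × A)} {size : ℕ} → p ≤ size →
    ResidueFamily f Ps size → ∀ {r} → r < p → Σ[ T ∈ List A ] (Pick Ps T × r ≡ residue f T)
  family-covers {f = f} p≤size (family Ls picks distinct many) r<p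
    with T , T∈Ls , r≡ ← ∈-map⁻ (residue f) (distinct-covers p (map (residue f) Ls)
           (AllPairs.map⁺ distinct) (All.map⁺ (All.universal (λ T → m%n<n (sumBy f T) p) Ls))
           (≤-trans p≤size (≤-trans many (≤-reflexive (sym (length-map (residue f) Ls))))) r<p)
    = T , All.lookup picks T∈Ls , r≡

  -- p - 1 pairs of distinct residues plus one extra element c contain a selection of size p:
  -- some pick T from the pairs has residue -c.
  pairing-selection : {A : Set} (f : A → ℕ) {ys : List A} {n : ℕ} →
    Pairing (λ x → f x % p) ys n → suc n ≡ p → Selection p f ys
  pairing-selection f (pairing Ps c others distinct refl arrangement) 1+|Ps|≡p
    with T , ((U , U↭) , len-T) , target≡ ←
           family-covers (≤-reflexive (sym 1+|Ps|≡p)) (residue-family f Ps distinct (≤-reflexive 1+|Ps|≡p))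
             (m%n<n (p ∸ f c % p) p)
    = selection (c ∷ T) (U ++ others , ys↭) (trans (cong suc len-T) 1+|Ps|≡p) (m%n≡0⇒n∣m _ p (begin
      (f c + sumBy f T) % p               ≡⟨ ≋-+ˡ (f c) (%-≋ (sumBy f T)) ⟨
      (f c + residue f T) % p             ≡⟨ cong (λ r → (f c + r) % p) target≡ ⟨
      (f c + (p ∸ f c % p) % p) % p       ≡⟨ ≋-+ˡ (f c) (%-≋ (p ∸ f c % p)) ⟩
      (f c + (p ∸ f c % p)) % p           ≡⟨ ≋-+ʳ (p ∸ f c % p) (%-≋ (f c)) ⟨
      (f c % p + (p ∸ f c % p)) % p       ≡⟨ cong (_% p) (m+[n∸m]≡n (<⇒≤ (m%n<n (f c) p))) ⟩
      p % p                               ≡⟨ n%n≡0 p ⟩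
      0                                   ∎))
    where
    open ≡-Reasoning
    ys↭ : _ ↭ (c ∷ T) ++ U ++ others
    ys↭ = ↭-trans arrangement (↭-trans (shift c (unpair Ps) others)
            (prep c (↭-trans (++⁺ʳ others U↭) (↭-reflexive (++-assoc T U others)))))

-- EGZ for primes: sort the 2p - 1 elements by residue and pair each of the first p - 1 with
-- the element p - 1 places later.
egz-prime : (p₁ : ℕ) → Prime (suc p₁) → EGZ (suc p₁)
egz-prime p₁ isPrime {A} f xs bound =
  selection-sub (sub-↭ xs↭PQ) (from-pair-up (pair-up key P [] Q sorted |P|<|Q|))
  where
  p = suc p₁
  key : A → ℕ
  key x = f x % p
  S = sortBy key xs
  P = take p₁ S
  Q = drop p₁ S
  sorted : Sorted key (P ++ [] ++ Q)
  sorted = subst (Sorted key) (sym (take++drop≡id p₁ S)) (sortBy-sorted key xs)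
  xs↭PQ : xs ↭ P ++ Q
  xs↭PQ = ↭-trans (↭-sym (sortBy-↭ key xs)) (↭-reflexive (sym (take++drop≡id p₁ S)))
  enough : p₁ + p ≤ length S
  enough = subst (p₁ + p ≤_) (sym (↭-length (sortBy-↭ key xs))) (≤-pred bound)
  |P|≡p₁ : length P ≡ p₁
  |P|≡p₁ = trans (length-take p₁ S) (m≤n⇒m⊓n≡m (m+n≤o⇒m≤o p₁ enough))
  |P|<|Q| : length P < length Q
  |P|<|Q| = subst₂ _≤_ (cong suc (sym |P|≡p₁)) (sym (length-drop p₁ S))
              (m+n≤o⇒m≤o∸n p (subst (_≤ length S) (+-comm p₁ p) enough))
  from-pair-up : ConstantRun key (P ++ [] ++ Q) (suc (length P + 0)) ⊎ Pairing key (P ++ Q) (length P) →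
    Selection p f (P ++ Q)
  from-pair-up (inj₁ run) = run-selection p f run (cong suc (trans (+-identityʳ _) |P|≡p₁))
  from-pair-up (inj₂ pairs) = Residues.pairing-selection p isPrime f pairs (cong suc |P|≡p₁)

egz : ∀ n → EGZ n
egz = <-rec EGZ step
  where
  step : ∀ n → (∀ {m} → m < n → EGZ m) → EGZ n
  step zero _ = egz-0
  step (suc zero) _ = egz-1
  step n@(suc (suc _)) egz-below with composite? n
  ... | no ¬composite = egz-prime _ (¬composite⇒prime ¬composite)
  ... | yes (hasNonTrivialDivisor {d} d<n (divides q@(suc _) n≡q*d)) =
    subst EGZ (sym n≡q*d) (egz-* d q {{>-nonZero (<-trans z<s 1<d)}} (egz-below d<n) (egz-below q<n))
    where
    1<d : 1 < d
    1<d = nonTrivial⇒n>1 d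
    q<n : q < n
    q<n = subst (q <_) (sym n≡q*d) (m<m*n q d 1<d)

-- With EGZ(a), k·a + a elements whose sum is divisible by a split entirely into k + 1 blocks:
-- after k blocks have been split off, the remaining a elements have sum divisible by a as well.
split-into-blocks : {a : ℕ} .{{_ : NonZero a}} → EGZ a → {A : Set} (f : A → ℕ) (k : ℕ) (xs : List A) →
  length xs ≡ k * a + a → a ∣ sumBy f xs →
  Σ[ Bs ∈ List (List A) ] (length Bs ≡ suc k × All (Block a f) Bs × xs ↭ concat Bs)
split-into-blocks {a} egz-a f k xs len a∣xs
  with blockSplit Bs R count valid xs↭ ←
         split-blocks egz-a f k xs (≤-trans (n≤1+n _) (≤-reflexive (cong suc (sym len))))
  = R ∷ Bs , cong suc count , (len-R , a∣R) ∷ valid , ↭-trans xs↭ (↭-++-comm (concat Bs) R)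
  where
  len-R : length R ≡ a
  len-R = +-cancelˡ-≡ (k * a) _ _ (begin
    k * a + length R                 ≡⟨ cong (λ l → l * a + length R) count ⟨
    length Bs * a + length R         ≡⟨ cong (_+ length R) (length-concat-blocks Bs valid) ⟨
    length (concat Bs) + length R    ≡⟨ length-++ (concat Bs) ⟨
    length (concat Bs ++ R)          ≡⟨ ↭-length xs↭ ⟨
    length xs                        ≡⟨ len ⟩
    k * a + a                        ∎)
    where open ≡-Reasoning
  a∣R : a ∣ sumBy f R
  a∣R = ∣m+n∣m⇒∣n (subst (a ∣_) (trans (sumBy-↭ f xs↭) (sumBy-++ f (concat Bs) R)) a∣xs)
                  (divides (sumBy (blockValue a f) Bs) (trans (sum-concat-blocks a f Bs valid) (*-comm a _)))

length-in-blocks : ∀ q₁ d → 2 * (suc q₁ * d) ∸ d ≡ (q₁ + q₁) * d + d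
length-in-blocks q₁ d = trans (cong (_∸ d) (double q₁ d)) (m+n∸n≡m ((q₁ + q₁) * d + d) d)
  where
  double : ∀ q₁ d → 2 * (suc q₁ * d) ≡ ((q₁ + q₁) * d + d) + d
  double = solve-∀

-- The 2n - d = (2q - 1)·d terms of J split into 2q - 1 blocks of
-- d terms with sums divisible by d; EGZ(q) applied to the block values selects q blocks whose
-- q·d = n terms have sum divisible by n.
proposition2p1 : (n d : ℕ) → n ≥ 1 → d ≥ 1 → d ∣ n →
    (J : List (Fin n)) → length J ≡ 2 * n ∸ d → IsZeroSum J →
    Σ[ T ∈ List (Fin n) ] (T ⊆ J × length T ≡ n × IsZeroSum T)
proposition2p1 n d n≥1 d≥1 (divides zero n≡0) J |J| zero-sum with () ← ≤-trans n≥1 (≤-reflexive n≡0)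
proposition2p1 n d n≥1 d≥1 d∣n@(divides (suc q₁) n≡q*d) J |J| zero-sum
  with Bs , count , valid , J↭ ← split-into-blocks {{>-nonZero d≥1}} (egz d) toℕ (q₁ + q₁) J
         (trans |J| (trans (cong (λ m → 2 * m ∸ d) n≡q*d) (length-in-blocks q₁ d))) (∣-trans d∣n zero-sum)
  with selection T T⊆Bs len-T sum-T ←
         combine-blocks d (suc q₁) {{>-nonZero d≥1}} (egz (suc q₁)) toℕ Bs valid
         (≤-reflexive (trans (cong suc (+-suc q₁ q₁)) (cong suc (sym count))))
  with T₀ , T₀⊆J , T₀↭T ← sub⇒sublist (sub-trans T⊆Bs (sub-↭ J↭))
  = T₀ , T₀⊆J , trans (↭-length T₀↭T) (trans len-T (sym n≡q*d)) ,
    subst₂ _∣_ (sym n≡q*d) (sym (sumBy-↭ toℕ T₀↭T)) sum-T
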